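{- Let $A$ be a subtraction algebra. Then $A$ has joins of all finite sets of pairwise compatible elements if and only if $A$ admits a generalised Boolean algebra structure whose partial order and relative complement operation are those of $A$.
   Context: A subtraction algebra is an algebra $(A,-)$ with one binary operation satisfying $a-(b-a)=a$, $a\cdot b=b\cdot a$ where $a\cdot b:=a-(a-b)$, and $(a-b)-c=(a-c)-b$; $\cdot$ is a semilattice operation with order $a\le b$ iff $a\cdot b=a$ and least element $0$. Regarding $A$ as a difference–restriction algebra with $\rhd:=\cdot$, two elements $a,b$ are compatible if $a\rhd b=b\rhd a$, i.e.\ $a\cdot b=b\cdot a$ (so every pair is compatible). A generalised Boolean algebra is a distributive lattice with a bottom element $\bot$ and a relative complement operation $-$ satisfying $a\wedge(b-a)=\bot$ and $a\vee(b-a)=a\vee b$. -}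

module Defs where

open import Data.Product using (Σ; _×_)
open import Data.List using (List)
open import Data.List.Relation.Unary.All using (All)
open import Data.List.Relation.Unary.AllPairs using (AllPairs)
open import Relation.Binary.PropositionalEquality using (_≡_)
open import Algebra.Lattice.Structures using (IsDistributiveLattice)
open import Function.Bundles using (_⇔_)

record SubtractionAlgebra : Set₁ where
  infixl 6 _-_
  field
    Carrier : Set
    _-_     : Carrier → Carrier → Carrier

  infixl 7 _·_
  _·_ : Carrier → Carrier → Carrier
  a · b = a - (a - b)

  field
    absorb : ∀ a b → a - (b - a) ≡ a
    ·-comm : ∀ a b → a · b ≡ b · a
    -swap  : ∀ a b c → (a - b) - c ≡ (a - c) - b

  infix 4 _≤_
  _≤_ : Carrier → Carrier → Set
  a ≤ b = a · b ≡ a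

  -- A as a difference–restriction algebra with ▹ := · ; compatibility
  Compatible : Carrier → Carrier → Set
  Compatible a b = a · b ≡ b · a

  IsJoin : Carrier → List Carrier → Set
  IsJoin j xs = All (_≤ j) xs × (∀ u → All (_≤ u) xs → j ≤ u)

  HasCompatibleJoins : Set
  HasCompatibleJoins =
    (xs : List Carrier) → AllPairs Compatible xs → Σ Carrier (λ j → IsJoin j xs)

  record GBAStructure : Set where
    field
      _∨_ _∧_   : Carrier → Carrier → Carrier
      ⊥         : Carrier
      isDistLat : IsDistributiveLattice _≡_ _∨_ _∧_
      ⊥-least   : ∀ a → ⊥ ∧ a ≡ ⊥
      compl-∧   : ∀ a b → a ∧ (b - a) ≡ ⊥
      compl-∨   : ∀ a b → a ∨ (b - a) ≡ a ∨ b
      same-order : ∀ a b → (a ∧ b ≡ a) ⇔ (a ≤ b)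

-- In a subtraction algebra every element x - x is the least element 0, the order is a
-- partial order with meet ·, and a ≤ b iff a - b = 0. If binary joins exist, meet
-- distributes over join: for z = a·(b ∨ c) - (a·b ∨ a·c), both b and c are disjoint
-- from z and below b ∨ c, hence below (b ∨ c) - z; as z ≤ b ∨ c this forces z ≤ (b ∨ c) - z,
-- so z = 0. Together with a ∨ (b - a) = a ∨ b this yields the generalised Boolean algebra.
-- Conversely the lattice join of a generalised Boolean algebra, folded from ⊥, gives
-- joins of all finite sets, compatible or not.
module Submission where

open import Defs
open import Data.Product using (Σ; _,_)
open import Data.List using (List; []; _∷_; foldr)
open import Data.List.Relation.Unary.All as All using (All; []; _∷_)
open import Data.List.Relation.Unary.AllPairs using ([]; _∷_)
open import Function.Bundles using (_⇔_; mk⇔; Equivalence)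
open import Relation.Binary.PropositionalEquality
open import Relation.Binary.Structures using (IsPartialOrder)
open import Relation.Binary.Lattice
  using (JoinSemilattice; Supremum; Infimum; IsLattice; IsDistributiveLattice; DistributiveLattice)
import Relation.Binary.Lattice.Properties.Lattice as LatticeProperties
import Relation.Binary.Lattice.Properties.DistributiveLattice as DistributiveLatticeProperties
import Algebra.Lattice.Structures as Alg

module SubtractionAlgebraProperties (A : SubtractionAlgebra) where
  open SubtractionAlgebra A
  open ≡-Reasoning

  x-y-y≡x-y : ∀ x y → (x - y) - y ≡ x - y
  x-y-y≡x-y x y = trans (cong ((x - y) -_) (sym (absorb y x))) (absorb (x - y) y)

  x·[y-x]≡x-x : ∀ x y → x · (y - x) ≡ x - x
  x·[y-x]≡x-x x y = cong (x -_) (absorb x y)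

  [y-x]-[y-x]≡x-x : ∀ x y → (y - x) - (y - x) ≡ x - x
  [y-x]-[y-x]≡x-x x y = begin
    (y - x) - (y - x)         ≡⟨ cong ((y - x) -_) (x-y-y≡x-y y x) ⟨
    (y - x) · x               ≡⟨ ·-comm (y - x) x ⟩
    x · (y - x)               ≡⟨ x·[y-x]≡x-x x y ⟩
    x - x                     ∎

  x-y-[y-x]≡x-y : ∀ x y → (x - y) - (y - x) ≡ x - y
  x-y-[y-x]≡x-y x y = trans (-swap x y (y - x)) (cong (_- y) (absorb x y))

  x-x≡y-y : ∀ x y → x - x ≡ y - y
  x-x≡y-y x y = begin
    x - x                     ≡⟨ [y-x]-[y-x]≡x-x x y ⟨
    (y - x) - (y - x)         ≡⟨ cong ((y - x) -_) (x-y-[y-x]≡x-y y x) ⟨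
    (y - x) · (x - y)         ≡⟨ ·-comm (y - x) (x - y) ⟩
    (x - y) · (y - x)         ≡⟨ cong ((x - y) -_) (x-y-[y-x]≡x-y x y) ⟩
    (x - y) - (x - y)         ≡⟨ [y-x]-[y-x]≡x-x y x ⟩
    y - y                     ∎

  [x-x]-y≡x-x : ∀ x y → (x - x) - y ≡ x - x
  [x-x]-y≡x-x x y = begin
    (x - x) - y               ≡⟨ cong (_- y) (x-x≡y-y x y) ⟩
    (y - y) - y               ≡⟨ x-y-y≡x-y y y ⟩
    y - y                     ≡⟨ x-x≡y-y y x ⟩
    x - x                     ∎

  x-[y-y]≡x : ∀ x y → x - (y - y) ≡ x
  x-[y-y]≡x x y = trans (cong (x -_) (x-x≡y-y y x)) (absorb x x)

  ≤-refl : ∀ x → x ≤ x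
  ≤-refl x = absorb x x

  ≤-antisym : ∀ {x y} → x ≤ y → y ≤ x → x ≡ y
  ≤-antisym {x} {y} x≤y y≤x = trans (sym x≤y) (trans (·-comm x y) y≤x)

  x-y≤x : ∀ x y → x - y ≤ x
  x-y≤x x y = begin
    (x - y) - ((x - y) - x)   ≡⟨ cong ((x - y) -_) (-swap x y x) ⟩
    (x - y) - ((x - x) - y)   ≡⟨ cong ((x - y) -_) ([x-x]-y≡x-x x y) ⟩
    (x - y) - (x - x)         ≡⟨ x-[y-y]≡x (x - y) x ⟩
    x - y                     ∎

  x-x·y≡x-y : ∀ x y → x - x · y ≡ x - y
  x-x·y≡x-y x y = trans (·-comm x (x - y)) (x-y≤x x y)

  x·y≤x : ∀ x y → x · y ≤ x
  x·y≤x x y = x-y≤x x (x - y)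

  x·y≤y : ∀ x y → x · y ≤ y
  x·y≤y x y = subst (_≤ y) (·-comm y x) (x·y≤x y x)

  ≤⇒x-y≡x-x : ∀ {x y} → x ≤ y → x - y ≡ x - x
  ≤⇒x-y≡x-x {x} {y} x≤y = trans (sym (x-x·y≡x-y x y)) (cong (x -_) x≤y)

  x-y≡z-z⇒≤ : ∀ {x y z} → x - y ≡ z - z → x ≤ y
  x-y≡z-z⇒≤ {x} {z = z} eq = trans (cong (x -_) eq) (x-[y-y]≡x x z)

  ≤⇒≡y·x : ∀ {x y} → x ≤ y → x ≡ y · x
  ≤⇒≡y·x {x} {y} x≤y = trans (sym x≤y) (·-comm x y)

  ≤-trans : ∀ {x y z} → x ≤ y → y ≤ z → x ≤ z
  ≤-trans {x} {y} {z} x≤y y≤z = x-y≡z-z⇒≤ (begin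
    x - z                     ≡⟨ cong (_- z) (≤⇒≡y·x x≤y) ⟩
    (y - (y - x)) - z         ≡⟨ -swap y (y - x) z ⟩
    (y - z) - (y - x)         ≡⟨ cong (_- (y - x)) (≤⇒x-y≡x-x y≤z) ⟩
    (y - y) - (y - x)         ≡⟨ [x-x]-y≡x-x y (y - x) ⟩
    y - y                     ∎)

  ≤-isPartialOrder : IsPartialOrder _≡_ _≤_
  ≤-isPartialOrder = record
    { isPreorder = record
      { isEquivalence = isEquivalence
      ; reflexive     = λ { refl → ≤-refl _ }
      ; trans         = ≤-trans
      }
    ; antisym = ≤-antisym
    }

  x-x≤y : ∀ x y → x - x ≤ y
  x-x≤y x y = trans (cong ((x - x) -_) ([x-x]-y≡x-x x y)) ([x-x]-y≡x-x x (x - x))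

  ≤x-x⇒≡x-x : ∀ {x y} → x ≤ y - y → x ≡ x - x
  ≤x-x⇒≡x-x {x} {y} x≤0 = trans (sym x≤0) (cong (x -_) (x-[y-y]≡x x y))

  x≤y-x⇒≡x-x : ∀ {x y} → x ≤ y - x → x ≡ x - x
  x≤y-x⇒≡x-x {x} {y} x≤y-x = trans (sym x≤y-x) (x·[y-x]≡x-x x y)

  -monoˡ-≤ : ∀ {x y} z → x ≤ y → x - z ≤ y - z
  -monoˡ-≤ {x} {y} z x≤y = x-y≡z-z⇒≤ (begin
    (x - z) - (y - z)                 ≡⟨ cong (λ t → (t - z) - (y - z)) (≤⇒≡y·x x≤y) ⟩
    ((y - (y - x)) - z) - (y - z)     ≡⟨ cong (_- (y - z)) (-swap y (y - x) z) ⟩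
    ((y - z) - (y - x)) - (y - z)     ≡⟨ -swap (y - z) (y - x) (y - z) ⟩
    ((y - z) - (y - z)) - (y - x)     ≡⟨ [x-x]-y≡x-x (y - z) (y - x) ⟩
    (y - z) - (y - z)                 ∎)

  -antitoneʳ-≤ : ∀ {x y} z → x ≤ y → z - y ≤ z - x
  -antitoneʳ-≤ {x} {y} z x≤y = x-y≡z-z⇒≤ (trans (-swap z y (z - x)) z·x-y≡0)
    where
    z·x-y≡0 : z · x - y ≡ (z · x - y) - (z · x - y)
    z·x-y≡0 = ≤x-x⇒≡x-x (subst (z · x - y ≤_) (≤⇒x-y≡x-x x≤y) (-monoˡ-≤ y (x·y≤y z x)))

  ·-greatest : ∀ {x y z} → z ≤ x → z ≤ y → z ≤ x · y
  ·-greatest {x} {y} {z} z≤x z≤y =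
    subst (_≤ x · y) (trans (·-comm x z) z≤x) (-antitoneʳ-≤ x (-antitoneʳ-≤ x z≤y))

  ·-monoˡ-≤ : ∀ {x y} z → x ≤ y → x · z ≤ y · z
  ·-monoˡ-≤ {x} z x≤y = ·-greatest (≤-trans (x·y≤x x z) x≤y) (x·y≤y x z)

  ·-infimum : Infimum _≤_ _·_
  ·-infimum x y = x·y≤x x y , x·y≤y x y , λ z → ·-greatest

  ≤∧-≤⇒≤ : ∀ {x y u} → x ≤ u → y - x ≤ u → y ≤ u
  ≤∧-≤⇒≤ {x} {y} {u} x≤u y-x≤u = x-y≡z-z⇒≤ (≤x-x⇒≡x-x {y = x} y-u≤0)
    where
    y-u≤0 : y - u ≤ x - x
    y-u≤0 = subst (y - u ≤_) (trans (·-comm (y - x) x) (x·[y-x]≡x-x x y))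
      (·-greatest (-antitoneʳ-≤ y x≤u) (≤-trans (-antitoneʳ-≤ y y-x≤u) (x·y≤y y x)))

  ≤∧·≡0⇒≤- : ∀ {x y z} → x ≤ y → x · z ≡ x - x → x ≤ y - z
  ≤∧·≡0⇒≤- {x} {y} {z} x≤y x·z≡0 = subst (_≤ y - z) x-z≡x (-monoˡ-≤ z x≤y)
    where
    x-z≡x : x - z ≡ x
    x-z≡x = trans (sym (x-x·y≡x-y x z)) (trans (cong (x -_) x·z≡0) (x-[y-y]≡x x x))

  ·≤⇒·[-]≡0 : ∀ {x y d} → x · y ≤ d → y · (x - d) ≡ y - y
  ·≤⇒·[-]≡0 {x} {y} {d} x·y≤d = ≤-antisym y·[x-d]≤0 (x-x≤y y _)
    where
    x-d≤x-y : x - d ≤ x - y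
    x-d≤x-y = subst (x - d ≤_) (x-x·y≡x-y x y) (-antitoneʳ-≤ x x·y≤d)
    y·[x-d]≤0 : y · (x - d) ≤ y - y
    y·[x-d]≤0 = subst₂ _≤_ (·-comm (x - d) y) (trans (·-comm (x - y) y) (x·[y-x]≡x-x y x))
      (·-monoˡ-≤ y x-d≤x-y)

module WithBinaryJoins
  (A : SubtractionAlgebra)
  (join : ∀ a b → Σ (SubtractionAlgebra.Carrier A)
                    (λ j → SubtractionAlgebra.IsJoin A j (a ∷ b ∷ [])))
  where
  open SubtractionAlgebra A
  open SubtractionAlgebraProperties A

  infixl 6 _∨_
  _∨_ : Carrier → Carrier → Carrier
  a ∨ b = Σ.proj₁ (join a b)

  ∨-supremum : Supremum _≤_ _∨_
  ∨-supremum a b with join a b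
  ... | _ , (a≤j ∷ b≤j ∷ []) , least = a≤j , b≤j , λ u a≤u b≤u → least u (a≤u ∷ b≤u ∷ [])

  isLattice : IsLattice _≡_ _≤_ _∨_ _·_
  isLattice = record
    { isPartialOrder = ≤-isPartialOrder
    ; supremum       = ∨-supremum
    ; infimum        = ·-infimum
    }

  open IsLattice isLattice using (x≤x∨y; y≤x∨y; ∨-least)

  ·-distribˡ-∨-≤ : ∀ a b c → a · (b ∨ c) ≤ a · b ∨ a · c
  ·-distribˡ-∨-≤ a b c = x-y≡z-z⇒≤ (x≤y-x⇒≡x-x (≤-trans z≤w w≤w-z))
    where
    w = b ∨ c
    d = a · b ∨ a · c
    z = a · w - d
    z≤w : z ≤ w
    z≤w = ≤-trans (x-y≤x (a · w) d) (x·y≤y a w)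
    ≤w-z : ∀ {e} → e ≤ w → a · e ≤ d → e ≤ w - z
    ≤w-z e≤w a·e≤d = ≤∧·≡0⇒≤- e≤w (·≤⇒·[-]≡0 (≤-trans (·-monoˡ-≤ _ (x·y≤x a w)) a·e≤d))
    w≤w-z : w ≤ w - z
    w≤w-z = ∨-least (≤w-z (x≤x∨y b c) (x≤x∨y _ _)) (≤w-z (y≤x∨y b c) (y≤x∨y _ _))

  isDistributiveLattice : IsDistributiveLattice _≡_ _≤_ _∨_ _·_
  isDistributiveLattice = record
    { isLattice    = isLattice
    ; ∧-distribˡ-∨ = λ a b c → ≤-antisym (·-distribˡ-∨-≤ a b c)
        (∨-least (·-monoʳ (x≤x∨y b c)) (·-monoʳ (y≤x∨y b c)))
    }
    where
    ·-monoʳ : ∀ {a x y} → x ≤ y → a · x ≤ a · y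
    ·-monoʳ {a} {x} x≤y = ·-greatest (x·y≤x a x) (≤-trans (x·y≤y a x) x≤y)

  x∨[y-x]≡x∨y : ∀ x y → x ∨ (y - x) ≡ x ∨ y
  x∨[y-x]≡x∨y x y = ≤-antisym
    (∨-least (x≤x∨y x y) (≤-trans (x-y≤x y x) (y≤x∨y x y)))
    (∨-least (x≤x∨y x _) (≤∧-≤⇒≤ (x≤x∨y x _) (y≤x∨y x _)))

  -- The bottom is e - e for an arbitrary element e; the carrier may be empty.
  gbaStructure : Carrier → GBAStructure
  gbaStructure e = record
    { _∨_        = _∨_
    ; _∧_        = _·_
    ; ⊥          = e - e
    ; isDistLat  = record
      { isLattice   = LatticeProperties.isAlgLattice distributiveLattice.lattice
      ; ∨-distrib-∧ = DistributiveLatticeProperties.∨-distrib-∧ distributiveLattice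
      ; ∧-distrib-∨ = DistributiveLatticeProperties.∧-distrib-∨ distributiveLattice
      }
    ; ⊥-least    = x-x≤y e
    ; compl-∧    = λ a b → trans (x·[y-x]≡x-x a b) (x-x≡y-y a e)
    ; compl-∨    = x∨[y-x]≡x∨y
    ; same-order = λ a b → mk⇔ (λ p → p) (λ p → p)
    }
    where
    distributiveLattice : DistributiveLattice _ _ _
    distributiveLattice = record { isDistributiveLattice = isDistributiveLattice }
    module distributiveLattice = DistributiveLattice distributiveLattice

module FiniteJoins {c ℓ₁ ℓ₂} (J : JoinSemilattice c ℓ₁ ℓ₂) where
  open JoinSemilattice J using (_≤_; _∨_; x≤x∨y; y≤x∨y; ∨-least) renaming (trans to ≤-trans)

  foldr-∨-upper : ∀ ⊥ xs → All (_≤ foldr _∨_ ⊥ xs) xs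
  foldr-∨-upper ⊥ []       = []
  foldr-∨-upper ⊥ (x ∷ xs) =
    x≤x∨y x _ ∷ All.map (λ y≤r → ≤-trans y≤r (y≤x∨y x _)) (foldr-∨-upper ⊥ xs)

  foldr-∨-least : ∀ {⊥ u} → ⊥ ≤ u → ∀ xs → All (_≤ u) xs → foldr _∨_ ⊥ xs ≤ u
  foldr-∨-least ⊥≤u []       []            = ⊥≤u
  foldr-∨-least ⊥≤u (x ∷ xs) (x≤u ∷ xs≤u) = ∨-least x≤u (foldr-∨-least ⊥≤u xs xs≤u)

module FromGBAStructure (A : SubtractionAlgebra) (G : SubtractionAlgebra.GBAStructure A) where
  open SubtractionAlgebra A
  open SubtractionAlgebraProperties A using (≤-isPartialOrder)
  open GBAStructure G
  open Alg.IsDistributiveLattice isDistLat using (∨-comm; ∧-absorbs-∨; ∧-distribʳ-∨)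
  open Equivalence using (to; from)

  ∨-supremum : Supremum _≤_ _∨_
  ∨-supremum x y =
    to (same-order x (x ∨ y)) (∧-absorbs-∨ x y) ,
    to (same-order y (x ∨ y)) (trans (cong (y ∧_) (∨-comm x y)) (∧-absorbs-∨ y x)) ,
    λ u x≤u y≤u → to (same-order (x ∨ y) u)
      (trans (∧-distribʳ-∨ u x y) (cong₂ _∨_ (from (same-order x u) x≤u) (from (same-order y u) y≤u)))

  joinSemilattice : JoinSemilattice _ _ _
  joinSemilattice = record
    { isJoinSemilattice = record { isPartialOrder = ≤-isPartialOrder ; supremum = ∨-supremum } }

  open FiniteJoins joinSemilattice

  hasCompatibleJoins : HasCompatibleJoins
  hasCompatibleJoins xs _ =
    foldr _∨_ ⊥ xs , foldr-∨-upper ⊥ xs , λ u → foldr-∨-least (to (same-order ⊥ u) (⊥-least u)) xs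

lemma6p2 : (A : SubtractionAlgebra) →
    SubtractionAlgebra.HasCompatibleJoins A ⇔ SubtractionAlgebra.GBAStructure A
lemma6p2 A = mk⇔ toGBA (FromGBAStructure.hasCompatibleJoins A)
  where
  open SubtractionAlgebra A

  toGBA : HasCompatibleJoins → GBAStructure
  toGBA H = WithBinaryJoins.gbaStructure A binaryJoin (Σ.proj₁ (H [] []))
    where
    binaryJoin : ∀ a b → Σ Carrier (λ j → IsJoin j (a ∷ b ∷ []))
    binaryJoin a b = H (a ∷ b ∷ []) ((·-comm a b ∷ []) ∷ [] ∷ [])
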